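{- Let $G=(V,E)$ be an undirected graph, let $s,t\in V$, and let $e_1=(u,u')$, $e_2=(v,v')$ be edges of $G$, where $s,t,u,u',v,v'$ are pairwise distinct. Suppose there is a simple cycle $L=((u,u'),P_{u'v'},(v',v),P_{vu})$ in $G$, where $P_{u'v'}$ is a path from $u'$ to $v'$ and $P_{vu}$ is a path from $v$ to $u$, such that $s,t\notin L$, and suppose there are mutually vertex-disjoint paths $P_1$ from $s$ to $L$ and $P_2$ from $t$ to $L$ such that either both $P_1$ and $P_2$ end at vertices of $P_{vu}$ or both end at vertices of $P_{u'v'}$. Then there exists a simple path from $s$ to $t$ in $G$ containing $e_1$ and $e_2$.
   Context: A path from a vertex to a cycle $L$ (or to a set of vertices) is a path from that vertex ending at a vertex of $L$ (of the set) and having no other vertex (in particular no internal vertex) in $L$ (in the set). -}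

module Defs where

open import Data.List using (List; []; _∷_; _++_)
open import Data.List.Membership.Propositional using (_∈_; _∉_)
open import Data.List.Relation.Unary.Unique.Propositional using (Unique)
open import Data.Sum using (_⊎_)
open import Data.Product using (_×_)
open import Relation.Binary.PropositionalEquality using (_≡_)

record Graph : Set₁ where
  field
    Vertex : Set
    Adj    : Vertex → Vertex → Set
    Adj-sym : ∀ {x y} → Adj x y → Adj y x

module _ (G : Graph) where
  open Graph G

  data Walk : Vertex → Vertex → Set where
    [_]  : (x : Vertex) → Walk x x
    _∷_ : ∀ {x y z} → Adj x y → Walk y z → Walk x z

  verts : ∀ {x y} → Walk x y → List Vertex
  verts [ x ] = x ∷ []
  verts (_∷_ {x} _ w) = x ∷ verts w

  IsPath : ∀ {x y} → Walk x y → Set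
  IsPath w = Unique (verts w)

data Consec {A : Set} (a b : A) : List A → Set where
  here  : ∀ {xs} → Consec a b (a ∷ b ∷ xs)
  there : ∀ {x xs} → Consec a b xs → Consec a b (x ∷ xs)

module _ {G : Graph} where
  open Graph G

  EdgeIn : ∀ {x y} → Vertex → Vertex → Walk G x y → Set
  EdgeIn a b w = Consec a b (verts G w) ⊎ Consec b a (verts G w)

  PathToSet : ∀ {x y} → List Vertex → Walk G x y → Set
  PathToSet {y = y} S w =
    IsPath G w × (y ∈ S) × (∀ z → z ∈ verts G w → z ∈ S → z ≡ y)

  Disjoint : ∀ {x y x' y'} → Walk G x y → Walk G x' y' → Set
  Disjoint w w' = ∀ z → z ∈ verts G w → z ∉ verts G w'

{-# OPTIONS --safe #-}
-- Order the endpoints a, b of P₁, P₂ along the arc of L that contains them, say a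
-- before b on the way from v to u. Cutting out the part of the arc between a and b
-- leaves the detour b … u –e₁– u' … v' –e₂– v … a, which runs around the rest of L
-- and so traverses both edges. Going s → a along P₁, backwards along the detour, and
-- a → t along P₂ reversed gives the required path: the three pieces are simple and
-- meet only at a and b, because P₁ and P₂ are disjoint and touch L only at their ends.
module Submission where

open import Defs
open import Data.List using (List; []; _∷_; _++_)
open import Data.List.Membership.Propositional using (_∈_; _∉_)
open import Data.List.Membership.Propositional.Properties using (∈-++⁺ˡ; ∈-++⁺ʳ; ∈-++⁻)
import Data.List.Relation.Binary.Disjoint.Propositional as List
open import Data.List.Relation.Unary.All using ([])
open import Data.List.Relation.Unary.All.Properties using (¬Any⇒All¬; All¬⇒¬Any; ++⁻ˡ; ++⁻ʳ)
import Data.List.Relation.Unary.AllPairs as AllPairs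
open import Data.List.Relation.Unary.Any using (here; there)
open import Data.List.Relation.Unary.Any.Properties using (++-comm)
open import Data.List.Relation.Unary.Unique.Propositional using (Unique; []; _∷_)
open import Data.List.Relation.Unary.Unique.Propositional.Properties using (++⁺; Unique[x∷xs]⇒x∉xs)
open import Data.Product using (Σ; ∃₂; _×_; _,_)
open import Data.Sum using (_⊎_; inj₁; inj₂; [_,_]′) renaming (swap to ⊎-swap)
open import Data.Empty using (⊥-elim)
open import Relation.Binary.PropositionalEquality using (_≡_; _≢_; refl; sym; trans; cong; subst)

module _ {A : Set} where

  Unique-∷⁺ : ∀ {x : A} {xs} → x ∉ xs → Unique xs → Unique (x ∷ xs)
  Unique-∷⁺ {xs = xs} x∉xs u = ¬Any⇒All¬ xs x∉xs ∷ u

  Unique-++⁻ : ∀ (xs : List A) {ys} → Unique (xs ++ ys) → Unique xs × Unique ys × List.Disjoint xs ys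
  Unique-++⁻ []       u          = [] , u , λ ()
  Unique-++⁻ (x ∷ xs) (x∉ ∷ u) with uxs , uys , xs#ys ← Unique-++⁻ xs u =
    Unique-∷⁺ (λ x∈xs → All¬⇒¬Any (++⁻ˡ xs x∉) x∈xs) uxs , uys ,
    λ { (here refl , x∈ys) → All¬⇒¬Any (++⁻ʳ xs x∉) x∈ys
      ; (there z∈xs , z∈ys) → xs#ys (z∈xs , z∈ys) }

  Unique-++-comm : ∀ (xs : List A) {ys} → Unique (xs ++ ys) → Unique (ys ++ xs)
  Unique-++-comm xs u with uxs , uys , xs#ys ← Unique-++⁻ xs u =
    ++⁺ uys uxs (λ (z∈ys , z∈xs) → xs#ys (z∈xs , z∈ys))

module _ {G : Graph} where
  open Graph G

  _++ʷ_ : ∀ {x y z} → Walk G x y → Walk G y z → Walk G x z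
  [ _ ]   ++ʷ q = q
  (e ∷ p) ++ʷ q = e ∷ (p ++ʷ q)

  reverseʷ : ∀ {x y} → Walk G x y → Walk G y x
  reverseʷ [ x ]          = [ x ]
  reverseʷ (_∷_ {x} e w) = reverseʷ w ++ʷ (Adj-sym e ∷ [ x ])

  ++ʷ-identityʳ : ∀ {x y} (p : Walk G x y) → p ++ʷ [ y ] ≡ p
  ++ʷ-identityʳ [ _ ]   = refl
  ++ʷ-identityʳ (e ∷ p) = cong (e ∷_) (++ʷ-identityʳ p)

  ++ʷ-assoc : ∀ {w x y z} (p : Walk G w x) (q : Walk G x y) (r : Walk G y z) →
    (p ++ʷ q) ++ʷ r ≡ p ++ʷ (q ++ʷ r)
  ++ʷ-assoc [ _ ]   q r = refl
  ++ʷ-assoc (e ∷ p) q r = cong (e ∷_) (++ʷ-assoc p q r)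

  verts-++ʷ-∷ : ∀ {x y y' z} (p : Walk G x y) (e : Adj y y') (q : Walk G y' z) →
    verts G (p ++ʷ (e ∷ q)) ≡ verts G p ++ verts G q
  verts-++ʷ-∷ [ _ ]   e q = refl
  verts-++ʷ-∷ (_ ∷ p) e q = cong (_ ∷_) (verts-++ʷ-∷ p e q)

  start∈verts : ∀ {x y} (w : Walk G x y) → x ∈ verts G w
  start∈verts [ _ ]   = here refl
  start∈verts (_ ∷ _) = here refl

  end∈verts : ∀ {x y} (w : Walk G x y) → y ∈ verts G w
  end∈verts [ _ ]   = here refl
  end∈verts (_ ∷ w) = there (end∈verts w)

  ∈-++ʷ⁺ˡ : ∀ {x y z v} (p : Walk G x y) (q : Walk G y z) → v ∈ verts G p → v ∈ verts G (p ++ʷ q)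
  ∈-++ʷ⁺ˡ [ _ ]   q (here refl) = start∈verts q
  ∈-++ʷ⁺ˡ (_ ∷ p) q (here refl) = here refl
  ∈-++ʷ⁺ˡ (_ ∷ p) q (there v∈p) = there (∈-++ʷ⁺ˡ p q v∈p)

  ∈-++ʷ⁺ʳ : ∀ {x y z v} (p : Walk G x y) {q : Walk G y z} → v ∈ verts G q → v ∈ verts G (p ++ʷ q)
  ∈-++ʷ⁺ʳ [ _ ]   v∈q = v∈q
  ∈-++ʷ⁺ʳ (_ ∷ p) v∈q = there (∈-++ʷ⁺ʳ p v∈q)

  ∈-++ʷ⁻ : ∀ {x y z v} (p : Walk G x y) (q : Walk G y z) →
    v ∈ verts G (p ++ʷ q) → v ∈ verts G p ⊎ v ∈ verts G q
  ∈-++ʷ⁻ [ _ ]   q v∈q         = inj₂ v∈q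
  ∈-++ʷ⁻ (_ ∷ p) q (here refl) = inj₁ (here refl)
  ∈-++ʷ⁻ (_ ∷ p) q (there v∈) = [ (λ v∈p → inj₁ (there v∈p)) , inj₂ ]′ (∈-++ʷ⁻ p q v∈)

  ∈-reverseʷ⁻ : ∀ {x y v} (w : Walk G x y) → v ∈ verts G (reverseʷ w) → v ∈ verts G w
  ∈-reverseʷ⁻ [ _ ]   v∈ = v∈
  ∈-reverseʷ⁻ (e ∷ w) v∈ with ∈-++ʷ⁻ (reverseʷ w) _ v∈
  ... | inj₁ v∈w′                = there (∈-reverseʷ⁻ w v∈w′)
  ... | inj₂ (here refl)         = there (start∈verts w)
  ... | inj₂ (there (here refl)) = here refl

  ∈-∃++ʷ : ∀ {x y a} (w : Walk G x y) → a ∈ verts G w →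
    ∃₂ λ (p : Walk G x a) (q : Walk G a y) → w ≡ p ++ʷ q
  ∈-∃++ʷ [ x ]   (here refl) = [ x ] , [ x ] , refl
  ∈-∃++ʷ (e ∷ w) (here refl) = [ _ ] , e ∷ w , refl
  ∈-∃++ʷ (e ∷ w) (there a∈w) with p , q , refl ← ∈-∃++ʷ w a∈w = e ∷ p , q , refl

  IsPath-++ʷ-∷⁺ : ∀ {x y y' z} (p : Walk G x y) (e : Adj y y') (q : Walk G y' z) →
    IsPath G p → IsPath G q → Disjoint p q → IsPath G (p ++ʷ (e ∷ q))
  IsPath-++ʷ-∷⁺ p e q pp pq p#q = subst Unique (sym (verts-++ʷ-∷ p e q))
    (++⁺ pp pq (λ (v∈p , v∈q) → p#q _ v∈p v∈q))

  IsPath-++ʷ-∷⁻ : ∀ {x y y' z} (p : Walk G x y) (e : Adj y y') (q : Walk G y' z) →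
    IsPath G (p ++ʷ (e ∷ q)) → IsPath G p × IsPath G q × Disjoint p q
  IsPath-++ʷ-∷⁻ p e q path with pp , pq , p#q ← Unique-++⁻ (verts G p) (subst Unique (verts-++ʷ-∷ p e q) path) =
    pp , pq , λ v v∈p v∈q → p#q (v∈p , v∈q)

  IsPath-++ʷ⁺ : ∀ {x y z} (p : Walk G x y) (q : Walk G y z) → IsPath G p → IsPath G q →
    (∀ v → v ∈ verts G p → v ∈ verts G q → v ≡ y) → IsPath G (p ++ʷ q)
  IsPath-++ʷ⁺ p [ _ ]   pp _  _    rewrite ++ʷ-identityʳ p = pp
  IsPath-++ʷ⁺ p (e ∷ q) pp pq meet = IsPath-++ʷ-∷⁺ p e q pp (AllPairs.tail pq) λ v v∈p v∈q →
    Unique[x∷xs]⇒x∉xs pq (subst (_∈ verts G q) (meet v v∈p (there v∈q)) v∈q)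

  IsPath-++ʷ⁻ : ∀ {x y z} (p : Walk G x y) (q : Walk G y z) → IsPath G (p ++ʷ q) →
    IsPath G p × IsPath G q × (∀ v → v ∈ verts G p → v ∈ verts G q → v ≡ y)
  IsPath-++ʷ⁻ p [ _ ] path rewrite ++ʷ-identityʳ p = path , [] ∷ [] , λ { v _ (here refl) → refl }
  IsPath-++ʷ⁻ p (e ∷ q) path with pp , pq , p#q ← IsPath-++ʷ-∷⁻ p e q path =
    pp , Unique-∷⁺ (p#q _ (end∈verts p)) pq ,
    λ { v _ (here refl) → refl ; v v∈p (there v∈q) → ⊥-elim (p#q v v∈p v∈q) }

  IsPath-reverseʷ : ∀ {x y} (w : Walk G x y) → IsPath G w → IsPath G (reverseʷ w)
  IsPath-reverseʷ [ _ ]          pw         = pw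
  IsPath-reverseʷ (_∷_ {x} e w) (x∉w ∷ pw) =
    IsPath-++ʷ-∷⁺ (reverseʷ w) (Adj-sym e) [ x ] (IsPath-reverseʷ w pw) ([] ∷ [])
      λ { _ x∈w′ (here refl) → All¬⇒¬Any x∉w (∈-reverseʷ⁻ w x∈w′) }

  IsPath-bridge : ∀ {x y a b} (P : Walk G x b) (K : Walk G b a) (P' : Walk G y a) →
    IsPath G P → IsPath G K → IsPath G P' → Disjoint P P' →
    (∀ v → v ∈ verts G P → v ∈ verts G K → v ≡ b) →
    (∀ v → v ∈ verts G P' → v ∈ verts G K → v ≡ a) →
    IsPath G (P ++ʷ (K ++ʷ reverseʷ P'))
  IsPath-bridge P K P' pP pK pP' P#P' meet meet' =
    IsPath-++ʷ⁺ P (K ++ʷ reverseʷ P') pP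
      (IsPath-++ʷ⁺ K (reverseʷ P') pK (IsPath-reverseʷ P' pP')
        λ v v∈K v∈P' → meet' v (∈-reverseʷ⁻ P' v∈P') v∈K)
      λ v v∈P v∈KP' → [ meet v v∈P , (λ v∈P' → ⊥-elim (P#P' v v∈P (∈-reverseʷ⁻ P' v∈P'))) ]′
                        (∈-++ʷ⁻ K (reverseʷ P') v∈KP')

  Consec-∷ : ∀ {x y z} (e : Adj x y) (w : Walk G y z) → Consec x y (verts G (e ∷ w))
  Consec-∷ e [ _ ]   = here
  Consec-∷ e (_ ∷ _) = here

  Consec-++ʷ-∷ : ∀ {x y y' z} (p : Walk G x y) (e : Adj y y') (q : Walk G y' z) →
    Consec y y' (verts G (p ++ʷ (e ∷ q)))
  Consec-++ʷ-∷ [ _ ]   e q = Consec-∷ e q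
  Consec-++ʷ-∷ (_ ∷ p) e q = there (Consec-++ʷ-∷ p e q)

  Consec-++ʷ⁺ˡ : ∀ {x y z a b} (p : Walk G x y) (q : Walk G y z) →
    Consec a b (verts G p) → Consec a b (verts G (p ++ʷ q))
  Consec-++ʷ⁺ˡ [ _ ]           q (there ())
  Consec-++ʷ⁺ˡ (e ∷ [ _ ])     q here      = Consec-∷ e q
  Consec-++ʷ⁺ˡ (_ ∷ (_ ∷ _))   q here      = here
  Consec-++ʷ⁺ˡ (_ ∷ p)         q (there c) = there (Consec-++ʷ⁺ˡ p q c)

  Consec-++ʷ⁺ʳ : ∀ {x y z a b} (p : Walk G x y) {q : Walk G y z} →
    Consec a b (verts G q) → Consec a b (verts G (p ++ʷ q))
  Consec-++ʷ⁺ʳ [ _ ]   c = c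
  Consec-++ʷ⁺ʳ (_ ∷ p) c = there (Consec-++ʷ⁺ʳ p c)

  Consec-reverseʷ : ∀ {x y a b} (w : Walk G x y) → Consec a b (verts G w) → Consec b a (verts G (reverseʷ w))
  Consec-reverseʷ [ _ ]                    (there ())
  Consec-reverseʷ (_∷_ {x} e w@([ _ ]))   here      = Consec-++ʷ-∷ (reverseʷ w) (Adj-sym e) [ x ]
  Consec-reverseʷ (_∷_ {x} e w@(_ ∷ _))   here      = Consec-++ʷ-∷ (reverseʷ w) (Adj-sym e) [ x ]
  Consec-reverseʷ (_ ∷ w)                  (there c) = Consec-++ʷ⁺ˡ (reverseʷ w) _ (Consec-reverseʷ w c)

  EdgeIn-++ʷ⁺ˡ : ∀ {x y z a b} (p : Walk G x y) (q : Walk G y z) → EdgeIn a b p → EdgeIn a b (p ++ʷ q)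
  EdgeIn-++ʷ⁺ˡ p q (inj₁ c) = inj₁ (Consec-++ʷ⁺ˡ p q c)
  EdgeIn-++ʷ⁺ˡ p q (inj₂ c) = inj₂ (Consec-++ʷ⁺ˡ p q c)

  EdgeIn-++ʷ⁺ʳ : ∀ {x y z a b} (p : Walk G x y) {q : Walk G y z} → EdgeIn a b q → EdgeIn a b (p ++ʷ q)
  EdgeIn-++ʷ⁺ʳ p (inj₁ c) = inj₁ (Consec-++ʷ⁺ʳ p c)
  EdgeIn-++ʷ⁺ʳ p (inj₂ c) = inj₂ (Consec-++ʷ⁺ʳ p c)

  EdgeIn-reverseʷ : ∀ {x y a b} (w : Walk G x y) → EdgeIn a b w → EdgeIn a b (reverseʷ w)
  EdgeIn-reverseʷ w (inj₁ c) = inj₂ (Consec-reverseʷ w c)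
  EdgeIn-reverseʷ w (inj₂ c) = inj₁ (Consec-reverseʷ w c)

  VisitsInOrder : ∀ {x y} → Walk G x y → Vertex → Vertex → Set
  VisitsInOrder {x} {y} w a b =
    Σ (Walk G x a) λ p → Σ (Walk G a b) λ m → Σ (Walk G b y) λ q → w ≡ p ++ʷ (m ++ʷ q)

  visitsInOrder : ∀ {x y a b} (w : Walk G x y) → a ∈ verts G w → b ∈ verts G w →
    VisitsInOrder w a b ⊎ VisitsInOrder w b a
  visitsInOrder w a∈w b∈w with p , r , refl ← ∈-∃++ʷ w a∈w with ∈-++ʷ⁻ p r b∈w
  ... | inj₂ b∈r with m , q , refl ← ∈-∃++ʷ r b∈r = inj₁ (p , m , q , refl)
  ... | inj₁ b∈p with p' , m , refl ← ∈-∃++ʷ p b∈p = inj₂ (p' , m , r , ++ʷ-assoc p' m r)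

  outerSegments : ∀ {x y a b} (p : Walk G x a) (m : Walk G a b) (q : Walk G b y) → a ≢ b →
    IsPath G (p ++ʷ (m ++ʷ q)) → IsPath G p × IsPath G q × Disjoint p q
  outerSegments p m q a≢b path
    with pp , pmq , meet ← IsPath-++ʷ⁻ p (m ++ʷ q) path
    with _ , pq , meet' ← IsPath-++ʷ⁻ m q pmq =
    pp , pq , λ v v∈p v∈q →
      a≢b (meet' _ (start∈verts m) (subst (_∈ verts G q) (meet v v∈p (∈-++ʷ⁺ʳ m v∈q)) v∈q))

  -- The cycle u –e₁– u' –c– v' –e₂– v –p– a … b –q– u with its part between a and b removed.
  arc : ∀ {u u' v v' a b} → Adj u u' → Adj v v' → Walk G u' v' → Walk G v a → Walk G b u → Walk G b a
  arc e₁ e₂ c p q = q ++ʷ (e₁ ∷ (c ++ʷ (Adj-sym e₂ ∷ p)))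

  module _ {u u' v v' a b} (e₁ : Adj u u') (e₂ : Adj v v') (c : Walk G u' v') (p : Walk G v a) (q : Walk G b u) where

    verts-arc : verts G (arc e₁ e₂ c p q) ≡ verts G q ++ (verts G c ++ verts G p)
    verts-arc = trans (verts-++ʷ-∷ q e₁ _) (cong (verts G q ++_) (verts-++ʷ-∷ c (Adj-sym e₂) p))

    ∈-arc⁻ : ∀ {z} → z ∈ verts G (arc e₁ e₂ c p q) → z ∈ verts G q ⊎ z ∈ verts G c ⊎ z ∈ verts G p
    ∈-arc⁻ z∈ = [ inj₁ , (λ z∈cp → inj₂ (∈-++⁻ (verts G c) z∈cp)) ]′
                  (∈-++⁻ (verts G q) (subst (_ ∈_) verts-arc z∈))

    IsPath-arc : IsPath G c → IsPath G p → IsPath G q →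
      Disjoint c p → Disjoint q c → Disjoint q p → IsPath G (arc e₁ e₂ c p q)
    IsPath-arc pc pp pq c#p q#c q#p = subst Unique (sym verts-arc)
      (++⁺ pq (++⁺ pc pp (λ (z∈c , z∈p) → c#p _ z∈c z∈p))
        λ (z∈q , z∈cp) → [ q#c _ z∈q , q#p _ z∈q ]′ (∈-++⁻ (verts G c) z∈cp))

    EdgeIn-arc₁ : EdgeIn u u' (arc e₁ e₂ c p q)
    EdgeIn-arc₁ = inj₁ (Consec-++ʷ-∷ q e₁ _)

    EdgeIn-arc₂ : EdgeIn v v' (arc e₁ e₂ c p q)
    EdgeIn-arc₂ = inj₂ (Consec-++ʷ⁺ʳ q (there (Consec-++ʷ-∷ c (Adj-sym e₂) p)))

  PathThrough : (s t u u' v v' : Vertex) → Set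
  PathThrough s t u u' v v' = Σ (Walk G s t) λ W → IsPath G W × EdgeIn u u' W × EdgeIn v v' W

  PathThrough-reverse : ∀ {s t u u' v v'} → PathThrough t s u u' v v' → PathThrough s t u u' v v'
  PathThrough-reverse (W , pW , e₁∈W , e₂∈W) =
    reverseʷ W , IsPath-reverseʷ W pW , EdgeIn-reverseʷ W e₁∈W , EdgeIn-reverseʷ W e₂∈W

  PathThrough-mirror : ∀ {s t u u' v v'} → PathThrough s t v' v u' u → PathThrough s t u u' v v'
  PathThrough-mirror (W , pW , e₂∈W , e₁∈W) = W , pW , ⊎-swap e₁∈W , ⊎-swap e₂∈W

  PathToSet-++-comm : ∀ {x y} (xs : List Vertex) {ys} {P : Walk G x y} →
    PathToSet (xs ++ ys) P → PathToSet (ys ++ xs) P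
  PathToSet-++-comm xs {ys} (pP , y∈ , meet) =
    pP , ++-comm xs ys y∈ , λ z z∈P z∈ → meet z z∈P (++-comm ys xs z∈)

  detour : ∀ {x y u u' v v' a b} (e₁ : Adj u u') (e₂ : Adj v v') (c : Walk G u' v')
    (p : Walk G v a) (m : Walk G a b) (q : Walk G b u) {P : Walk G x b} {P' : Walk G y a} →
    Unique (verts G c ++ verts G (p ++ʷ (m ++ʷ q))) →
    PathToSet (verts G c ++ verts G (p ++ʷ (m ++ʷ q))) P →
    PathToSet (verts G c ++ verts G (p ++ʷ (m ++ʷ q))) P' →
    Disjoint P P' → PathThrough x y u u' v v'
  detour e₁ e₂ c p m q {P} {P'} cycle (pP , _ , meet) (pP' , _ , meet') P#P' =
    P ++ʷ (K ++ʷ reverseʷ P') ,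
    IsPath-bridge P K P' pP pK pP' P#P' (λ z z∈P z∈K → meet z z∈P (K⊆L z∈K))
                                        (λ z z∈P' z∈K → meet' z z∈P' (K⊆L z∈K)) ,
    EdgeIn-++ʷ⁺ʳ P (EdgeIn-++ʷ⁺ˡ K _ (EdgeIn-arc₁ e₁ e₂ c p q)) ,
    EdgeIn-++ʷ⁺ʳ P (EdgeIn-++ʷ⁺ˡ K _ (EdgeIn-arc₂ e₁ e₂ c p q))
    where
    K = arc e₁ e₂ c p q
    w = p ++ʷ (m ++ʷ q)

    a≢b : _ ≢ _
    a≢b refl = P#P' _ (end∈verts P) (end∈verts P')

    p⊆w : ∀ {z} → z ∈ verts G p → z ∈ verts G w
    p⊆w = ∈-++ʷ⁺ˡ p (m ++ʷ q)

    q⊆w : ∀ {z} → z ∈ verts G q → z ∈ verts G w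
    q⊆w z∈q = ∈-++ʷ⁺ʳ p (∈-++ʷ⁺ʳ m z∈q)

    K⊆L : ∀ {z} → z ∈ verts G K → z ∈ verts G c ++ verts G w
    K⊆L z∈K = [ (λ z∈q → ∈-++⁺ʳ (verts G c) (q⊆w z∈q))
              , [ ∈-++⁺ˡ , (λ z∈p → ∈-++⁺ʳ (verts G c) (p⊆w z∈p)) ]′ ]′ (∈-arc⁻ e₁ e₂ c p q z∈K)

    pK : IsPath G K
    pK with pc , pw , c#w ← Unique-++⁻ (verts G c) cycle
       with pp , pq , p#q ← outerSegments p m q a≢b pw =
      IsPath-arc e₁ e₂ c p q pc pp pq
        (λ z z∈c z∈p → c#w (z∈c , p⊆w z∈p))
        (λ z z∈q z∈c → c#w (z∈c , q⊆w z∈q))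
        (λ z z∈q z∈p → p#q z z∈p z∈q)

  pathThroughBothEdges : ∀ {s t u u' v v' a b} (e₁ : Adj u u') (e₂ : Adj v v')
    (c : Walk G u' v') (w : Walk G v u) {P₁ : Walk G s a} {P₂ : Walk G t b} →
    Unique (verts G c ++ verts G w) →
    PathToSet (verts G c ++ verts G w) P₁ → PathToSet (verts G c ++ verts G w) P₂ →
    Disjoint P₁ P₂ → a ∈ verts G w → b ∈ verts G w → PathThrough s t u u' v v'
  pathThroughBothEdges e₁ e₂ c w cycle toL₁ toL₂ P₁#P₂ a∈w b∈w with visitsInOrder w a∈w b∈w
  ... | inj₁ (p , m , q , refl) =
    PathThrough-reverse (detour e₁ e₂ c p m q cycle toL₂ toL₁ λ z z∈P₂ z∈P₁ → P₁#P₂ z z∈P₁ z∈P₂)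
  ... | inj₂ (p , m , q , refl) = detour e₁ e₂ c p m q cycle toL₁ toL₂ P₁#P₂

lemma1 : (G : Graph) → (s t u u' v v' : Graph.Vertex G) →
    s ≢ t → s ≢ u → s ≢ u' → s ≢ v → s ≢ v' →
    t ≢ u → t ≢ u' → t ≢ v → t ≢ v' →
    u ≢ u' → u ≢ v → u ≢ v' →
    u' ≢ v → u' ≢ v' →
    v ≢ v' →
    (e₁ : Graph.Adj G u u') → (e₂ : Graph.Adj G v v') →
    (Pu'v' : Walk G u' v') → (Pvu : Walk G v u) →
    Unique (verts G Pu'v' ++ verts G Pvu) →
    s ∉ (verts G Pu'v' ++ verts G Pvu) →
    t ∉ (verts G Pu'v' ++ verts G Pvu) →
    ∀ {a b} → (P₁ : Walk G s a) → (P₂ : Walk G t b) →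
    PathToSet (verts G Pu'v' ++ verts G Pvu) P₁ →
    PathToSet (verts G Pu'v' ++ verts G Pvu) P₂ →
    Disjoint P₁ P₂ →
    ((a ∈ verts G Pvu) × (b ∈ verts G Pvu)) ⊎ ((a ∈ verts G Pu'v') × (b ∈ verts G Pu'v')) →
    Σ (Walk G s t) (λ W → IsPath G W × EdgeIn u u' W × EdgeIn v v' W)
lemma1 G s t u u' v v' _ _ _ _ _ _ _ _ _ _ _ _ _ _ _ e₁ e₂ Pu'v' Pvu cycle _ _ P₁ P₂ toL₁ toL₂ P₁#P₂
  (inj₁ (a∈Pvu , b∈Pvu)) =
  pathThroughBothEdges e₁ e₂ Pu'v' Pvu cycle toL₁ toL₂ P₁#P₂ a∈Pvu b∈Pvu
lemma1 G s t u u' v v' _ _ _ _ _ _ _ _ _ _ _ _ _ _ _ e₁ e₂ Pu'v' Pvu cycle _ _ P₁ P₂ toL₁ toL₂ P₁#P₂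
  (inj₂ (a∈Pu'v' , b∈Pu'v')) =
  PathThrough-mirror (pathThroughBothEdges (Graph.Adj-sym G e₂) (Graph.Adj-sym G e₁) Pvu Pu'v'
    (Unique-++-comm (verts G Pu'v') cycle)
    (PathToSet-++-comm (verts G Pu'v') toL₁) (PathToSet-++-comm (verts G Pu'v') toL₂)
    P₁#P₂ a∈Pu'v' b∈Pu'v')
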